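{- Let $P$ be a polyomino. If there exists a set of $m$ rooks that dominates $P$, then there exists a set of at most $m$ non-attacking rooks that dominates $P$.
   Context: A polyomino is a finite union of unit squares (tiles) of the standard grid in $\mathbb{R}^2$ with connected interior. Two tiles of $P$ are in the same row (resp. column) of $P$ if the segment joining their centers is horizontal (resp. vertical) and contained in $P$. A rook on a tile guards (attacks) that tile and every tile in the same row or column of $P$. A set of rooks dominates $P$ if every tile of $P$ is guarded by some rook. A set of rooks on distinct tiles is non-attacking if no two of them are in the same row or column of $P$. -}

module Defs where

open import Data.Nat using (ℕ)
open import Data.Integer using (ℤ; _-_; ∣_∣; _≤_)
open import Data.Product using (_×_; _,_; proj₁; proj₂)
open import Data.Sum using (_⊎_)
open import Data.List using (List; length)
open import Data.List.Membership.Propositional using (_∈_)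
open import Data.List.Relation.Unary.All using (All)
open import Data.List.Relation.Unary.Any using (Any)
open import Data.List.Relation.Unary.Unique.Propositional using (Unique)
open import Data.List.Relation.Unary.AllPairs using (AllPairs)
open import Relation.Binary.PropositionalEquality using (_≡_)
open import Relation.Nullary using (¬_)

-- A tile is identified with the integer coordinates (x , y) of its lower-left corner.
Tile : Set
Tile = ℤ × ℤ

Tiles : Set
Tiles = List Tile

Adjacent : Tile → Tile → Set
Adjacent (x₁ , y₁) (x₂ , y₂) = ∣ x₁ - x₂ ∣ Data.Nat.+ ∣ y₁ - y₂ ∣ ≡ 1

data Reachable (P : Tiles) : Tile → Tile → Set where
  here : ∀ {a} → Reachable P a a
  step : ∀ {a b c} → Adjacent a b → b ∈ P → Reachable P b c → Reachable P a c

-- A finite union of unit squares has connected interior iff its tiles are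
-- connected under edge-adjacency.
IsPolyomino : Tiles → Set
IsPolyomino P = ∀ {a b} → a ∈ P → b ∈ P → Reachable P a b

Between : ℤ → ℤ → ℤ → Set
Between u v w = (u ≤ w × w ≤ v) ⊎ (v ≤ w × w ≤ u)

-- Two tiles of P are in the same row of P: the horizontal segment joining their
-- centres lies in P, i.e. every tile between them on that row belongs to P.
SameRow : Tiles → Tile → Tile → Set
SameRow P (x₁ , y₁) (x₂ , y₂) =
  (x₁ , y₁) ∈ P × (x₂ , y₂) ∈ P × y₁ ≡ y₂ × (∀ x → Between x₁ x₂ x → (x , y₁) ∈ P)

SameCol : Tiles → Tile → Tile → Set
SameCol P (x₁ , y₁) (x₂ , y₂) =
  (x₁ , y₁) ∈ P × (x₂ , y₂) ∈ P × x₁ ≡ x₂ × (∀ y → Between y₁ y₂ y → (x₁ , y) ∈ P)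

Guards : Tiles → Tile → Tile → Set
Guards P r t = r ≡ t ⊎ SameRow P r t ⊎ SameCol P r t

IsRookSet : Tiles → List Tile → Set
IsRookSet P R = Unique R × All (_∈ P) R

Dominates : Tiles → List Tile → Set
Dominates P R = ∀ {t} → t ∈ P → Any (λ r → Guards P r t) R

NonAttacking : Tiles → List Tile → Set
NonAttacking P R = AllPairs (λ r s → ¬ SameRow P r s × ¬ SameCol P r s) R

-- The rows of P and the columns of P are two partial equivalence relations on tiles, reflexive
-- on P, and the argument uses nothing else about them. While two rooks r and s attack each
-- other, say along a row, remove s. If the remaining rooks still dominate, the set got smaller.
-- Otherwise some tile t was guarded by s alone, hence along the column of s (r guards s and the
-- whole row of s); move the rook from s to t. The rooks still dominate, since r takes over the
-- row of s and t its column, and the row of t, which contained no rook before, now does. So each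
-- step decreases, lexicographically, the number of rooks and then the number of tiles outside
-- the rows of all rooks plus the number of tiles outside their columns.

module Submission where

open import Defs using (Tile; Tiles; Between)
open import Data.Nat as ℕ using (ℕ; suc; z≤n; s≤s; _≤_; _<_)
open import Data.Nat.Properties as ℕP using (allUpTo?)
open import Data.Nat.Induction using (<-wellFounded)
open import Data.Integer as ℤ using (ℤ; +_; ∣_∣; _-_; _+_; -_; _≤?_; +≤+)
import Data.Integer.Properties as ℤP
open import Data.Integer.Tactic.RingSolver using (solve-∀)
open import Data.Product using (Σ; ∃; ∃₂; _×_; _,_; proj₁; proj₂; uncurry)
open import Data.Product.Properties using (≡-dec)
open import Data.Product.Relation.Binary.Lex.Strict using (×-Lex; ×-wellFounded)
open import Data.Sum as Sum using (_⊎_; inj₁; inj₂; [_,_]′)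
open import Data.List using (List; []; _∷_; length; filter)
open import Data.List.Properties using (length-removeAt′)
open import Data.List.Membership.Propositional using (_∈_; find; lose)
open import Data.List.Relation.Binary.Subset.Propositional using (_⊆_)
open import Data.List.Relation.Unary.Any as Any using (Any; here; there; any?; index; _─_)
open import Data.List.Relation.Unary.All as All using (All; _∷_; all?)
open import Data.List.Relation.Unary.All.Properties using (anti-mono; ¬Any⇒All¬; ¬All⇒Any¬)
open import Data.List.Relation.Unary.AllPairs using (AllPairs; []; _∷_)
open import Data.List.Relation.Unary.Unique.Propositional using (Unique)
open import Function using (_∘_; _on_)
open import Induction.WellFounded using (WellFounded; Acc; acc)
open import Level using (0ℓ)
open import Relation.Binary using (Rel; Symmetric; Transitive; Decidable; DecidableEquality)
import Relation.Binary.Construct.On as On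
open import Relation.Binary.PropositionalEquality as ≡ using (_≡_; _≢_; refl; cong; subst; subst₂; module ≡-Reasoning)
open import Relation.Nullary using (¬_; Dec; yes; no; ¬?; contradiction)
open import Relation.Nullary.Decidable using (map′; _×-dec_; _⊎-dec_)
import Relation.Unary as U

module _ {A : Set} where

  ─-⊆ : ∀ {x : A} {xs} (x∈xs : x ∈ xs) → (xs ─ x∈xs) ⊆ xs
  ─-⊆ (here refl)  y∈          = there y∈
  ─-⊆ (there x∈xs) (here refl) = here refl
  ─-⊆ (there x∈xs) (there y∈)  = there (─-⊆ x∈xs y∈)

  length-─ : ∀ {x : A} {xs} (x∈xs : x ∈ xs) → length xs ≡ suc (length (xs ─ x∈xs))
  length-─ {xs = xs} x∈xs = length-removeAt′ xs (index x∈xs)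

  Any-─⁻ : ∀ {Q : U.Pred A 0ℓ} {x xs} (x∈xs : x ∈ xs) → Any Q xs → Q x ⊎ Any Q (xs ─ x∈xs)
  Any-─⁻ (here refl)  (here qx) = inj₁ qx
  Any-─⁻ (here refl)  (there q) = inj₂ q
  Any-─⁻ (there x∈xs) (here qy) = inj₂ (here qy)
  Any-─⁻ (there x∈xs) (there q) = Sum.map₂ there (Any-─⁻ x∈xs q)

  Unique-─ : ∀ {x : A} {xs} (x∈xs : x ∈ xs) → Unique xs → Unique (xs ─ x∈xs)
  Unique-─ (here refl)  (_ ∷ u)  = u
  Unique-─ (there x∈xs) (y∉ ∷ u) = anti-mono (─-⊆ x∈xs) y∉ ∷ Unique-─ x∈xs u

  module _ {Q Q′ : U.Pred A 0ℓ} (Q? : U.Decidable Q) (Q′? : U.Decidable Q′) (Q⊆Q′ : Q U.⊆ Q′) where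

    length-filter-mono : ∀ xs → length (filter Q? xs) ≤ length (filter Q′? xs)
    length-filter-mono []       = z≤n
    length-filter-mono (x ∷ xs) with Q? x | Q′? x
    ... | yes _  | yes _   = s≤s (length-filter-mono xs)
    ... | yes qx | no ¬q′x = contradiction (Q⊆Q′ qx) ¬q′x
    ... | no _   | yes _   = ℕP.m≤n⇒m≤1+n (length-filter-mono xs)
    ... | no _   | no _    = length-filter-mono xs

    length-filter-mono-< : ∀ {xs} → Any (λ x → Q′ x × ¬ Q x) xs → length (filter Q? xs) < length (filter Q′? xs)
    length-filter-mono-< {x ∷ xs} (here (q′x , ¬qx)) with Q? x | Q′? x
    ... | yes qx | _       = contradiction qx ¬qx
    ... | no _   | yes _   = s≤s (length-filter-mono xs)
    ... | no _   | no ¬q′x = contradiction q′x ¬q′x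
    length-filter-mono-< {x ∷ xs} (there w) with Q? x | Q′? x
    ... | yes _  | yes _   = s≤s (length-filter-mono-< w)
    ... | yes qx | no ¬q′x = contradiction (Q⊆Q′ qx) ¬q′x
    ... | no _   | yes _   = ℕP.m<n⇒m<1+n (length-filter-mono-< w)
    ... | no _   | no _    = length-filter-mono-< w

-- Rook domination for two families of lines

record Lines {T : Set} (P : List T) : Set₁ where
  field
    _∼_     : Rel T 0ℓ
    _∼?_    : Decidable _∼_
    sym     : Symmetric _∼_
    trans   : Transitive _∼_
    refl-on : ∀ {a} → a ∈ P → a ∼ a

module RookDomination {T : Set} (_≟_ : DecidableEquality T) (P : List T) where

  IsRookSet : List T → Set
  IsRookSet R = Unique R × All (_∈ P) R

  Covered : Lines P → List T → U.Pred T 0ℓ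
  Covered L R p = Any (λ r → r ∼ p) R where open Lines L

  covered? : ∀ L R → U.Decidable (Covered L R)
  covered? L R p = any? (λ r → r ∼? p) R where open Lines L

  uncovered : Lines P → List T → ℕ
  uncovered L R = length (filter (¬? ∘ covered? L R) P)

  module _ (L : Lines P) {R R′ : List T} (cover : Covered L R U.⊆ Covered L R′) where

    uncovered-mono : uncovered L R′ ≤ uncovered L R
    uncovered-mono = length-filter-mono _ _ (λ ¬c′ c → ¬c′ (cover c)) P

    uncovered-mono-< : ∀ {t} → t ∈ P → Covered L R′ t → ¬ Covered L R t → uncovered L R′ < uncovered L R
    uncovered-mono-< t∈P c′ ¬c = length-filter-mono-< _ _ (λ ¬c′ c → ¬c′ (cover c)) (lose t∈P (¬c , λ ¬c′ → ¬c′ c′))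

  module Guarding (L M : Lines P) where
    module L = Lines L
    module M = Lines M

    Guards : T → T → Set
    Guards r t = r ≡ t ⊎ r L.∼ t ⊎ r M.∼ t

    Guarded : List T → U.Pred T 0ℓ
    Guarded R t = Any (λ r → Guards r t) R

    Dominates : List T → Set
    Dominates R = ∀ {t} → t ∈ P → Guarded R t

    NonAttacking : List T → Set
    NonAttacking = AllPairs (λ r s → ¬ r L.∼ s × ¬ r M.∼ s)

    guarded? : ∀ R t → Dec (Guarded R t)
    guarded? R t = any? (λ r → r ≟ t ⊎-dec r L.∼? t ⊎-dec r M.∼? t) R

    dominates-or-unguarded : ∀ R → Dominates R ⊎ ∃ λ t → t ∈ P × ¬ Guarded R t
    dominates-or-unguarded R with all? (guarded? R) P
    ... | yes guarded = inj₁ (All.lookup guarded)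
    ... | no ¬guarded = inj₂ (find (¬All⇒Any¬ (guarded? R) P ¬guarded))

    module _ {R r s} (rookSet : IsRookSet R) (dom : Dominates R) (r∈R : r ∈ R) (s∈R : s ∈ R)
             (r≢s : r ≢ s) (r∼s : r L.∼ s) where

      private
        R₀ : List T
        R₀ = R ─ s∈R

      r∈R₀ : r ∈ R₀
      r∈R₀ = [ (λ r≡s → contradiction r≡s r≢s) , (λ r∈ → r∈) ]′ (Any-─⁻ s∈R r∈R)

      rookSet₀ : IsRookSet R₀
      rookSet₀ = Unique-─ s∈R (proj₁ rookSet) , anti-mono (─-⊆ s∈R) (proj₂ rookSet)

      module Replace {t} (t∈P : t ∈ P) (¬guarded : ¬ Guarded R₀ t) where

        ¬r∼t : ¬ r L.∼ t
        ¬r∼t r∼t = ¬guarded (lose r∈R₀ (inj₂ (inj₁ r∼t)))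

        s∼t : s M.∼ t
        s∼t with Any-─⁻ s∈R (dom t∈P)
        ... | inj₂ guarded₀          = contradiction guarded₀ ¬guarded
        ... | inj₁ (inj₁ refl)       = contradiction r∼s ¬r∼t
        ... | inj₁ (inj₂ (inj₁ s∼t)) = contradiction (L.trans r∼s s∼t) ¬r∼t
        ... | inj₁ (inj₂ (inj₂ s∼t)) = s∼t

        ¬L-covered : ¬ Covered L R t
        ¬L-covered c with Any-─⁻ s∈R c
        ... | inj₁ s∼t = ¬r∼t (L.trans r∼s s∼t)
        ... | inj₂ c₀  = ¬guarded (Any.map (inj₂ ∘ inj₁) c₀)

        R₁ : List T
        R₁ = t ∷ R₀

        rookSet₁ : IsRookSet R₁
        rookSet₁ = (All.tabulate (λ y∈R₀ t≡y → ¬guarded (lose y∈R₀ (inj₁ (≡.sym t≡y)))) ∷ proj₁ rookSet₀)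
                 , (t∈P ∷ proj₂ rookSet₀)

        L-cover : Covered L R U.⊆ Covered L R₁
        L-cover c = [ (λ s∼p → there (lose r∈R₀ (L.trans r∼s s∼p))) , there ]′ (Any-─⁻ s∈R c)

        M-cover : Covered M R U.⊆ Covered M R₁
        M-cover c = [ (λ s∼p → here (M.trans (M.sym s∼t) s∼p)) , there ]′ (Any-─⁻ s∈R c)

        dominates₁ : Dominates R₁
        dominates₁ {p} p∈P = [ replaced , there ]′ (Any-─⁻ s∈R (dom p∈P))
          where
          replaced : Guards s p → Guarded R₁ p
          replaced (inj₁ refl)       = there (lose r∈R₀ (inj₂ (inj₁ r∼s)))
          replaced (inj₂ (inj₁ s∼p)) = there (lose r∈R₀ (inj₂ (inj₁ (L.trans r∼s s∼p))))
          replaced (inj₂ (inj₂ s∼p)) = here (inj₂ (inj₂ (M.trans (M.sym s∼t) s∼p)))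

      exchange : (IsRookSet R₀ × Dominates R₀)
               ⊎ ∃ λ t → IsRookSet (t ∷ R₀) × Dominates (t ∷ R₀)
                         × uncovered L (t ∷ R₀) < uncovered L R × uncovered M (t ∷ R₀) ≤ uncovered M R
      exchange with dominates-or-unguarded R₀
      ... | inj₁ dom₀                 = inj₁ (rookSet₀ , dom₀)
      ... | inj₂ (t , t∈P , ¬guarded) = inj₂ (t , rookSet₁ , dominates₁
                                         , uncovered-mono-< L L-cover t∈P (here (L.refl-on t∈P)) ¬L-covered
                                         , uncovered-mono M M-cover)
        where open Replace t∈P ¬guarded

  dominates-swap : ∀ L M {R} → Guarding.Dominates L M R → Guarding.Dominates M L R
  dominates-swap L M dom p∈P = Any.map (Sum.map₂ Sum.swap) (dom p∈P)

  module Descent (L M : Lines P) where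
    open Guarding L M

    measure : List T → ℕ × ℕ
    measure R = length R , uncovered L R ℕ.+ uncovered M R

    _≺_ : Rel (List T) 0ℓ
    _≺_ = ×-Lex _≡_ _<_ _<_ on measure

    ≺-wellFounded : WellFounded _≺_
    ≺-wellFounded = On.wellFounded measure (×-wellFounded <-wellFounded <-wellFounded)

    ≺⇒length≤ : ∀ {R′ R} → R′ ≺ R → length R′ ≤ length R
    ≺⇒length≤ (inj₁ shorter)           = ℕP.<⇒≤ shorter
    ≺⇒length≤ (inj₂ (same-length , _)) = ℕP.≤-reflexive same-length

    ─-≺ : ∀ {s R} (s∈R : s ∈ R) → (R ─ s∈R) ≺ R
    ─-≺ s∈R = inj₁ (ℕP.≤-reflexive (≡.sym (length-─ s∈R)))

    Conflict : List T → Set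
    Conflict R = ∃₂ λ r s → r ∈ R × s ∈ R × r ≢ s × (r L.∼ s ⊎ r M.∼ s)

    nonAttacking-or-conflict : ∀ {R} → Unique R → NonAttacking R ⊎ Conflict R
    nonAttacking-or-conflict [] = inj₁ []
    nonAttacking-or-conflict {x ∷ xs} (x∉xs ∷ u) with any? (λ s → x L.∼? s ⊎-dec x M.∼? s) xs
    ... | yes attacked = let s , s∈xs , x⚔s = find attacked
                         in inj₂ (x , s , here refl , there s∈xs , All.lookup x∉xs s∈xs , x⚔s)
    ... | no ¬attacked with nonAttacking-or-conflict u
    ...   | inj₁ nonAttacking = inj₁ (All.map (λ ¬⚔ → ¬⚔ ∘ inj₁ , ¬⚔ ∘ inj₂) (¬Any⇒All¬ xs ¬attacked) ∷ nonAttacking)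
    ...   | inj₂ (r , s , r∈ , s∈ , r≢s , r⚔s) = inj₂ (r , s , there r∈ , there s∈ , r≢s , r⚔s)

    improve : ∀ {R} → IsRookSet R → Dominates R → Conflict R → ∃ λ R′ → IsRookSet R′ × Dominates R′ × R′ ≺ R
    improve rs dom (r , s , r∈R , s∈R , r≢s , inj₁ r∼s) with exchange rs dom r∈R s∈R r≢s r∼s
    ... | inj₁ (rs₀ , dom₀) = _ , rs₀ , dom₀ , ─-≺ s∈R
    ... | inj₂ (t , rs₁ , dom₁ , <L , ≤M) =
          _ , rs₁ , dom₁ , inj₂ (≡.sym (length-─ s∈R) , ℕP.+-mono-<-≤ <L ≤M)
    improve rs dom (r , s , r∈R , s∈R , r≢s , inj₂ r∼s)
      with Guarding.exchange M L rs (dominates-swap L M dom) r∈R s∈R r≢s r∼s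
    ... | inj₁ (rs₀ , dom₀) = _ , rs₀ , dominates-swap M L dom₀ , ─-≺ s∈R
    ... | inj₂ (t , rs₁ , dom₁ , <M , ≤L) =
          _ , rs₁ , dominates-swap M L dom₁ , inj₂ (≡.sym (length-─ s∈R) , ℕP.+-mono-≤-< ≤L <M)

    Solution : ℕ → Set
    Solution m = ∃ λ R′ → IsRookSet R′ × length R′ ≤ m × NonAttacking R′ × Dominates R′

    descend : ∀ {R} → Acc _≺_ R → IsRookSet R → Dominates R → Solution (length R)
    descend {R} (acc rec) rs dom with nonAttacking-or-conflict (proj₁ rs)
    ... | inj₁ na = R , rs , ℕP.≤-refl , na , dom
    ... | inj₂ c with improve rs dom c
    ...   | R′ , rs′ , dom′ , R′≺R with descend (rec R′≺R) rs′ dom′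
    ...     | R″ , rs″ , R″≤R′ , na , dom″ = R″ , rs″ , ℕP.≤-trans R″≤R′ (≺⇒length≤ R′≺R) , na , dom″

    nonAttacking-domination : ∀ R → IsRookSet R → Dominates R → Solution (length R)
    nonAttacking-domination R = descend (≺-wellFounded R)

-- Rows and columns of a set of tiles

i≤j⇒i+∣j-i∣≡j : ∀ {i j} → i ℤ.≤ j → i + + ∣ j - i ∣ ≡ j
i≤j⇒i+∣j-i∣≡j {i} {j} i≤j = begin
  i + + ∣ j - i ∣  ≡⟨ cong (_+_ i) (ℤP.0≤i⇒+∣i∣≡i (ℤP.i≤j⇒0≤j-i i≤j)) ⟩
  i + (j - i)      ≡⟨ cancel i j ⟩
  j                ∎
  where
  open ≡-Reasoning
  cancel : ∀ a b → a + (b - a) ≡ b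
  cancel = solve-∀

∣j-i∣≤∣k-i∣ : ∀ {i j k} → i ℤ.≤ j → j ℤ.≤ k → ∣ j - i ∣ ≤ ∣ k - i ∣
∣j-i∣≤∣k-i∣ {i} i≤j j≤k = ℤP.drop‿+≤+ (subst₂ ℤ._≤_
  (≡.sym (ℤP.0≤i⇒+∣i∣≡i (ℤP.i≤j⇒0≤j-i i≤j)))
  (≡.sym (ℤP.0≤i⇒+∣i∣≡i (ℤP.i≤j⇒0≤j-i (ℤP.≤-trans i≤j j≤k))))
  (ℤP.+-monoˡ-≤ (- i) j≤k))

AllBetween : (ℤ → Set) → ℤ → ℤ → Set
AllBetween Q u v = ∀ w → Between u v w → Q w

Between-sym : ∀ {u v w} → Between u v w → Between v u w
Between-sym = Sum.swap

Between-self : ∀ {u w} → Between u u w → w ≡ u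
Between-self (inj₁ (u≤w , w≤u)) = ℤP.≤-antisym w≤u u≤w
Between-self (inj₂ (u≤w , w≤u)) = ℤP.≤-antisym w≤u u≤w

module _ {Q : ℤ → Set} where

  AllBetween-sym : ∀ {u v} → AllBetween Q u v → AllBetween Q v u
  AllBetween-sym all w = all w ∘ Between-sym

  AllBetween-trans : ∀ {u v z} → AllBetween Q u v → AllBetween Q v z → AllBetween Q u z
  AllBetween-trans {v = v} uv vz w (inj₁ (u≤w , w≤z)) with w ≤? v
  ... | yes w≤v = uv w (inj₁ (u≤w , w≤v))
  ... | no  w≰v = vz w (inj₁ (ℤP.<⇒≤ (ℤP.≰⇒> w≰v) , w≤z))
  AllBetween-trans {v = v} uv vz w (inj₂ (z≤w , w≤u)) with w ≤? v
  ... | yes w≤v = vz w (inj₂ (z≤w , w≤v))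
  ... | no  w≰v = uv w (inj₂ (ℤP.<⇒≤ (ℤP.≰⇒> w≰v) , w≤u))

  module _ (Q? : U.Decidable Q) where

    interval? : ∀ lo hi → Dec (∀ x → lo ℤ.≤ x → x ℤ.≤ hi → Q x)
    interval? lo hi with lo ≤? hi
    ... | no lo≰hi = yes λ x lo≤x x≤hi → contradiction (ℤP.≤-trans lo≤x x≤hi) lo≰hi
    ... | yes lo≤hi = map′ fromOffsets toOffsets (allUpTo? (λ n → Q? (lo + + n)) (suc ∣ hi - lo ∣))
      where
      fromOffsets : (∀ {n} → n < suc ∣ hi - lo ∣ → Q (lo + + n)) → ∀ x → lo ℤ.≤ x → x ℤ.≤ hi → Q x
      fromOffsets h x lo≤x x≤hi = subst Q (i≤j⇒i+∣j-i∣≡j lo≤x) (h (s≤s (∣j-i∣≤∣k-i∣ lo≤x x≤hi)))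
      toOffsets : (∀ x → lo ℤ.≤ x → x ℤ.≤ hi → Q x) → ∀ {n} → n < suc ∣ hi - lo ∣ → Q (lo + + n)
      toOffsets h {n} (s≤s n≤d) = h (lo + + n) (ℤP.i≤i+j lo (+ n))
        (subst (lo + + n ℤ.≤_) (i≤j⇒i+∣j-i∣≡j lo≤hi) (ℤP.+-monoʳ-≤ lo (+≤+ n≤d)))

    allBetween? : ∀ u v → Dec (AllBetween Q u v)
    allBetween? u v = map′ (λ (uv , vu) w → [ uncurry (uv w) , uncurry (vu w) ]′)
                           (λ all → (λ w u≤w w≤v → all w (inj₁ (u≤w , w≤v))) , (λ w v≤w w≤u → all w (inj₂ (v≤w , w≤u))))
                           (interval? u v ×-dec interval? v u)

_≟ᵗ_ : DecidableEquality Tile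
_≟ᵗ_ = ≡-dec ℤ._≟_ ℤ._≟_

open import Data.List.Membership.DecPropositional _≟ᵗ_ using (_∈?_)

module Segments (P : Tiles) (tile : ℤ → ℤ → Tile) (line pos : Tile → ℤ)
                (tile-line-pos : ∀ a → tile (line a) (pos a) ≡ a) where

  Aligned : Rel Tile 0ℓ
  Aligned a b = a ∈ P × b ∈ P × line a ≡ line b × AllBetween (λ w → tile (line a) w ∈ P) (pos a) (pos b)

  aligned? : ∀ a b → Dec (Aligned a b)
  aligned? a b = a ∈? P ×-dec b ∈? P ×-dec line a ℤ.≟ line b
                 ×-dec allBetween? (λ w → tile (line a) w ∈? P) (pos a) (pos b)

  aligned-sym : Symmetric Aligned
  aligned-sym {a} {b} (a∈P , b∈P , same , seg) =
    b∈P , a∈P , ≡.sym same , subst (λ l → AllBetween (λ w → tile l w ∈ P) (pos b) (pos a)) same (AllBetween-sym seg)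

  aligned-trans : Transitive Aligned
  aligned-trans {a} {b} {c} (a∈P , _ , ab , seg₁) (_ , c∈P , bc , seg₂) =
    a∈P , c∈P , ≡.trans ab bc , AllBetween-trans seg₁ (subst (λ l → AllBetween (λ w → tile l w ∈ P) (pos b) (pos c)) (≡.sym ab) seg₂)

  aligned-refl : ∀ {a} → a ∈ P → Aligned a a
  aligned-refl {a} a∈P = a∈P , a∈P , refl , λ w w∈ →
    subst (_∈ P) (≡.sym (≡.trans (cong (tile (line a)) (Between-self w∈)) (tile-line-pos a))) a∈P

  lines : Lines P
  lines = record { _∼_ = Aligned ; _∼?_ = aligned? ; sym = aligned-sym ; trans = aligned-trans ; refl-on = aligned-refl }

rows cols : (P : Tiles) → Lines P
rows P = Segments.lines P (λ y x → x , y) proj₂ proj₁ (λ _ → refl)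
cols P = Segments.lines P _,_ proj₁ proj₂ (λ _ → refl)

open Defs using (IsPolyomino; IsRookSet; Dominates; NonAttacking)

lemma14 : (P : Tiles) → IsPolyomino P → (m : ℕ) → (R : List Tile) →
            IsRookSet P R → length R ≡ m → Dominates P R →
            Σ (List Tile) (λ R′ → IsRookSet P R′ × length R′ ≤ m × NonAttacking P R′ × Dominates P R′)
lemma14 P _ m R rookSet refl = RookDomination.Descent.nonAttacking-domination _≟ᵗ_ P (rows P) (cols P) R rookSet
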